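{- Let $G=(\Sigma,I,L,\rightarrow)$ be a transition system, let $R_i$ be a preorder on $\Sigma$, and let $\sigma_i\subseteq\mathrm{post}^*(I)$. Consider an execution of Algorithm 2 (described in the context) on input $G,R_i,\sigma_i$ that terminates after $t$ iterations with output $\langle P,\tau,Q,\sigma\rangle$. For $j=0,\dots,t$: - let $\langle P_j,\tau_j,Q_j\rangle$ be the 2PR triple after $j$ iterations; - let $R_j=R_{\langle P_j,\tau_j,Q_j\rangle}$. Let $x,y\in\Sigma$ satisfy $R_i(x)=R_i(y)$. Then: - if $P(x)\neq P(y)$, then $R_j(x)\neq R_j(y)$ for some $j\in[0,t]$; - if $Q(x)\neq Q(y)$, then $R_j^{ -1}(x)\neq R_j^{ -1}(y)$ for some $j\in[0,t]$.
   Context: Notation. - $G=(\Sigma,I,L,\rightarrow)$ has states $\Sigma$, initial states $I$, finite label set $L$, and transitions $x\xrightarrow{a}y$. - $\mathrm{pre}_a(Y)=\{x\mid\exists y\in Y.\ x\xrightarrow{a}y\}$. - $\mathrm{post}(X)=\{y\mid\exists x\in X,a.\ x\xrightarrow{a}y\}$ and $\mathrm{post}^*(X)=\bigcup_n\mathrm{post}^n(X)$. - For a relation $R$: $R(x)=\{y\mid (x,y)\in R\}$ and $R(S)=\bigcup_{x\in S}R(x)$. - For a partition $P$, $P(x)$ is the block of $P$ containing $x$. 2PR triples. A 2PR triple is $\langle P,\tau,Q\rangle$, with $P,Q$ partitions of $\Sigma$ and $\tau:P\to\wp(Q)$. It encodes the relation $R_{\langle P,\tau,Q\rangle}(x)=\bigcup\tau(P(x))$.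 Algorithm 2. Initialization: - $P:=\{\{y\mid R_i(y)=R_i(x)\}\mid x\in\Sigma\}$; - $Q:=\{\{y\mid R_i^{ -1}(y)=R_i^{ -1}(x)\}\mid x\in\Sigma\}$; - $\tau(B):=\{C\in Q\mid C\subseteq R_i(B)\}$ for each $B\in P$; - $\sigma:=\sigma_i$. Each iteration does the following. - Compute \[U=\{B\in P\mid\textstyle\bigcup\tau(B)\cap\sigma=\varnothing,\ \bigcup\tau(B)\cap(I\cup\mathrm{post}(\sigma))\neq\varnothing\}\] and \[V=\{\langle a,B,C\rangle\in L\times P^2\mid\textstyle\bigcup\tau(B)\cap\sigma\neq\varnothing,\ B\cap\mathrm{pre}_a(C)\neq\varnothing,\ \bigcup\tau(B)\not\subseteq\mathrm{pre}_a(\bigcup\tau(C))\}.\] - Then nondeterministically execute one enabled guarded command: - (Search) if $U\neq\varnothing$: choose $B\in U$ and $s\in\bigcup\tau(B)\cap(I\cup\mathrm{post}(\sigma))$, and set $\sigma:=\sigma\cup\{s\}$. - (Refine) if $V\neq\varnothing$: choose $\langle a,B,C\rangle\in V$ and perform these steps in order. 1. Let $S:=\mathrm{pre}_a(\bigcup\tau(C))$, $B':=B\cap\mathrm{pre}_a(C)$ and $B'':=B\setminus\mathrm{pre}_a(C)$. 2. In $P$, replace $B$ by $B'$ and $B''$, and set $\tau(B'):=\tau(B)$ and $\tau(B''):=\tau(B)$. 3. For each $X\in\tau(B')$ with $X\cap S\neq\varnothing$ and $X\not\subseteq S$: replace $X$ in $Q$ and in every $\tau(A)$ by $X\cap S$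 and $X\setminus S$. 4. Set $\tau(B'):=\{E\in\tau(B')\mid E\subseteq S\}$. - if $U=V=\varnothing$: return $\langle P,\tau,Q,\sigma\rangle$. -}

module Defs where

open import Level using (0ℓ)
open import Data.Nat using (ℕ)
open import Data.Fin using (Fin)
open import Data.Product using (∃; ∃₂; _×_; _,_)
open import Data.Sum using (_⊎_)
open import Data.Unit using (⊤)
open import Data.List using (List; []; _∷_)
open import Relation.Nullary using (¬_)
open import Relation.Unary using (Pred)
open import Relation.Binary using (Rel)
open import Relation.Binary.PropositionalEquality using (_≡_)
open import Function.Bundles using (_⇔_)

record TS : Set₁ where
  field
    St    : Set
    Init  : Pred St 0ℓ
    nLab  : ℕ
    Trans : St → Fin nLab → St → Set

SetEq : {A : Set} → Pred A 0ℓ → Pred A 0ℓ → Set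
SetEq A B = ∀ z → A z ⇔ B z

module Alg2 (G : TS) where
  open TS G

  Lab : Set
  Lab = Fin nLab

  pre : Lab → Pred St 0ℓ → Pred St 0ℓ
  pre a Y x = ∃ λ y → Trans x a y × Y y

  post : Pred St 0ℓ → Pred St 0ℓ
  post X y = ∃₂ λ x a → X x × Trans x a y

  data PostStar (X : Pred St 0ℓ) : Pred St 0ℓ where
    base : ∀ {y} → X y → PostStar X y
    step : ∀ {x a y} → PostStar X x → Trans x a y → PostStar X y

  -- State of Algorithm 2: a 2PR triple <P, τ, Q> together with σ.
  -- Encoding of the triple:
  --   PEq x y  iff  P(x) = P(y)      (x, y lie in the same block of P)
  --   QEq x y  iff  Q(x) = Q(y)
  --   Tau x y  iff  Q(y) ∈ τ(P(x)), i.e.  y ∈ ⋃ τ(P(x)) = R_<P,τ,Q>(x)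
  -- Blocks of P (resp. Q) are represented by any of their elements.
  record AState : Set₁ where
    field
      PEq   : Rel St 0ℓ
      Tau   : Rel St 0ℓ
      QEq   : Rel St 0ℓ
      sigma : Pred St 0ℓ

  open AState public

  Rel2PR : AState → St → Pred St 0ℓ
  Rel2PR s x y = Tau s x y

  Rel2PRinv : AState → St → Pred St 0ℓ
  Rel2PRinv s x z = Tau s z x

  initState : Rel St 0ℓ → Pred St 0ℓ → AState
  initState Ri σi = record
    { PEq   = PI
    ; Tau   = λ x y → ∀ w → QI y w → ∃ λ z → PI x z × Ri z w
    ; QEq   = QI
    ; sigma = σi
    }
    where
      PI : Rel St 0ℓ
      PI x y = ∀ z → Ri x z ⇔ Ri y z
      QI : Rel St 0ℓ
      QI x y = ∀ z → Ri z x ⇔ Ri z y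

  -- Nondeterministic choices made by one iteration.
  --   search b s     : B = P(b) ∈ U and s ∈ ⋃τ(B) ∩ (I ∪ post(σ))
  --   refine a b c   : <a, P(b), P(c)> ∈ V
  data Choice : Set where
    search : St → St → Choice
    refine : Lab → St → St → Choice

  module _ (st : AState) where
    InU : St → Set
    InU b = ¬ (∃ λ y → Tau st b y × sigma st y)
          × (∃ λ s → Tau st b s × (Init s ⊎ post (sigma st) s))

    InV : Lab → St → St → Set
    InV a b c = (∃ λ y → Tau st b y × sigma st y)
              × (∃ λ z → PEq st b z × pre a (PEq st c) z)
              × ¬ (∀ y → Tau st b y → pre a (Tau st c) y)

    Enabled : Choice → Set
    Enabled (search b s) = ¬ (∃ λ y → Tau st b y × sigma st y)
                         × Tau st b s × (Init s ⊎ post (sigma st) s)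
    Enabled (refine a b c) = InV a b c

    Terminal : Set
    Terminal = ¬ (∃ λ b → InU b) × ¬ (∃ λ a → ∃₂ λ b c → InV a b c)

    apply : Choice → AState
    apply (search b s) = record
      { PEq = PEq st ; Tau = Tau st ; QEq = QEq st
      ; sigma = λ z → sigma st z ⊎ z ≡ s }
    apply (refine a b c) = record
      { PEq = PEq' ; Tau = Tau' ; QEq = QEq' ; sigma = sigma st }
      where
        B : Pred St 0ℓ
        B z = PEq st b z
        S : Pred St 0ℓ
        S = pre a (Tau st c)
        preC : Pred St 0ℓ
        preC = pre a (PEq st c)
        PEq' : Rel St 0ℓ
        PEq' x y = (¬ B x × PEq st x y)
                 ⊎ (B x × B y × preC x × preC y)
                 ⊎ (B x × B y × ¬ preC x × ¬ preC y)
        -- x lies in a block X = Q(w) ∈ τ(B') = τ(B) with X ∩ S ≠ ∅ and X ⊄ S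
        Split : Pred St 0ℓ
        Split x = ∃ λ w → Tau st b w × QEq st w x
                  × (∃ λ z → QEq st w z × S z)
                  × ¬ (∀ z → QEq st w z → S z)
        QEq' : Rel St 0ℓ
        QEq' x y = (¬ Split x × QEq st x y)
                 ⊎ (Split x × QEq st x y × S x × S y)
                 ⊎ (Split x × QEq st x y × ¬ S x × ¬ S y)
        -- step 3 keeps ⋃τ(A) for every A; step 4 restricts τ(B')
        -- to the (new) Q-blocks contained in S
        Tau' : Rel St 0ℓ
        Tau' z y = (¬ (B z × preC z) × Tau st z y)
                 ⊎ (B z × preC z × Tau st z y × (∀ w → QEq' y w → S w))

  run : AState → List Choice → AState
  run st []       = st
  run st (c ∷ cs) = run (apply st c) cs

  Valid : AState → List Choice → Set
  Valid st []       = ⊤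
  Valid st (c ∷ cs) = Enabled st c × Valid (apply st c) cs

-- Each iteration only splits blocks: Search leaves P, τ, Q unchanged, and Refine cuts
-- B = P(b) along pre_a(C) and the Q-blocks of τ(B) along S = pre_a(⋃τ(C)). As R_i(x) = R_i(y)
-- puts x and y in one P-block and, R_i being a preorder, in one Q-block of the initial
-- triple, any final separation happens at some Refine step, and R_j detects it right after:
-- B ∩ pre_a(C) keeps in its image only Q-blocks inside S, so it loses a state of ⋃τ(B) ∖ S
-- that B ∖ pre_a(C) keeps; dually, of a split Q-block the half inside S stays in the image
-- of B ∩ pre_a(C) and the other half leaves it.
module Submission where

open import Defs
open import Level using (0ℓ)
open import Axiom.ExcludedMiddle using (ExcludedMiddle)
open import Data.Nat using (suc; _≤_; s≤s; z≤n)
open import Data.Product using (∃; _×_; _,_; proj₂)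
open import Data.Sum using (_⊎_; inj₁; inj₂)
open import Data.Empty using (⊥-elim)
open import Data.List using (List; []; _∷_; length; take)
open import Function.Base using (_∘_; flip)
open import Function.Bundles using (mk⇔; Equivalence)
open import Function.Properties.Equivalence using (⇔-isEquivalence)
open import Relation.Nullary using (¬_; yes; no)
open import Relation.Nullary.Decidable using (decidable-stable)
open import Relation.Unary using (Pred; _⊆_)
open import Relation.Binary using (Rel; _Respects_)
open import Relation.Binary.Structures using (IsEquivalence; IsPreorder)
open import Relation.Binary.PropositionalEquality using (_≡_)
import Relation.Binary.Construct.On as On

SetEq-isEquivalence : {A : Set} → IsEquivalence (SetEq {A})
SetEq-isEquivalence = record
  { refl  = λ _ → ⇔.refl
  ; sym   = λ e z → ⇔.sym (e z)
  ; trans = λ e f z → ⇔.trans (e z) (f z)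
  }
  where module ⇔ = IsEquivalence ⇔-isEquivalence

module SetEq {A : Set} = IsEquivalence (SetEq-isEquivalence {A})

preorder-image⇒preimage : {A : Set} {_≲_ : Rel A 0ℓ} → IsPreorder _≡_ _≲_ →
  ∀ {x y} → SetEq (x ≲_) (y ≲_) → SetEq (_≲ x) (_≲ y)
preorder-image⇒preimage pre {x} {y} h z =
  mk⇔ (λ z≲x → trans z≲x (Equivalence.from (h y) refl))
      (λ z≲y → trans z≲y (Equivalence.to (h x) refl))
  where open IsPreorder pre using (refl; trans)

-- Steps 2 and 3 of Refine both have this shape: the ≈-classes inside R are cut along X.
splitWithin : {A : Set} → Rel A 0ℓ → Pred A 0ℓ → Pred A 0ℓ → Rel A 0ℓ
splitWithin _≈_ R X x y = (¬ R x × x ≈ y)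
                        ⊎ (R x × x ≈ y × X x × X y)
                        ⊎ (R x × x ≈ y × ¬ X x × ¬ X y)

module SplitWithin {A : Set} (_≈_ : Rel A 0ℓ) (R X : Pred A 0ℓ) where

  splitWithin⇒≈ : ∀ {x y} → splitWithin _≈_ R X x y → x ≈ y
  splitWithin⇒≈ (inj₁ (_ , x≈y))            = x≈y
  splitWithin⇒≈ (inj₂ (inj₁ (_ , x≈y , _))) = x≈y
  splitWithin⇒≈ (inj₂ (inj₂ (_ , x≈y , _))) = x≈y

  splitWithin-closed : ∀ {x y} → R x → X x → splitWithin _≈_ R X x y → X y
  splitWithin-closed rx _  (inj₁ (¬rx , _))                = ⊥-elim (¬rx rx)
  splitWithin-closed _  _  (inj₂ (inj₁ (_ , _ , _ , xy)))  = xy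
  splitWithin-closed _  xx (inj₂ (inj₂ (_ , _ , ¬xx , _))) = ⊥-elim (¬xx xx)

  ¬splitWithin⇒separated : ExcludedMiddle 0ℓ → ∀ {x y} → x ≈ y → ¬ splitWithin _≈_ R X x y →
    R x × (X x × ¬ X y ⊎ ¬ X x × X y)
  ¬splitWithin⇒separated em {x} {y} x≈y ¬split with em {R x}
  ... | no ¬rx = ⊥-elim (¬split (inj₁ (¬rx , x≈y)))
  ... | yes rx with em {X x} | em {X y}
  ... | yes xx | yes xy = ⊥-elim (¬split (inj₂ (inj₁ (rx , x≈y , xx , xy))))
  ... | no ¬xx | no ¬xy = ⊥-elim (¬split (inj₂ (inj₂ (rx , x≈y , ¬xx , ¬xy))))
  ... | yes xx | no ¬xy = rx , inj₁ (xx , ¬xy)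
  ... | no ¬xx | yes xy = rx , inj₂ (¬xx , xy)

  splitWithin-isEquivalence : ExcludedMiddle 0ℓ → IsEquivalence _≈_ → R Respects _≈_ →
    IsEquivalence (splitWithin _≈_ R X)
  splitWithin-isEquivalence em isEq R-resp = record { refl = refl′ ; sym = sym′ ; trans = trans′ }
    where
    open IsEquivalence isEq

    R-resp⁻ : ∀ {x y} → x ≈ y → R y → R x
    R-resp⁻ = R-resp ∘ sym

    refl′ : ∀ {x} → splitWithin _≈_ R X x x
    refl′ {x} with em {R x} | em {X x}
    ... | no ¬rx | _      = inj₁ (¬rx , refl)
    ... | yes rx | yes xx = inj₂ (inj₁ (rx , refl , xx , xx))
    ... | yes rx | no ¬xx = inj₂ (inj₂ (rx , refl , ¬xx , ¬xx))

    sym′ : ∀ {x y} → splitWithin _≈_ R X x y → splitWithin _≈_ R X y x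
    sym′ (inj₁ (¬rx , x≈y))                   = inj₁ (¬rx ∘ R-resp⁻ x≈y , sym x≈y)
    sym′ (inj₂ (inj₁ (rx , x≈y , xx , xy)))   = inj₂ (inj₁ (R-resp x≈y rx , sym x≈y , xy , xx))
    sym′ (inj₂ (inj₂ (rx , x≈y , ¬xx , ¬xy))) = inj₂ (inj₂ (R-resp x≈y rx , sym x≈y , ¬xy , ¬xx))

    trans′ : ∀ {x y z} → splitWithin _≈_ R X x y → splitWithin _≈_ R X y z → splitWithin _≈_ R X x z
    trans′ (inj₁ (¬rx , x≈y)) (inj₁ (_ , y≈z))            = inj₁ (¬rx , trans x≈y y≈z)
    trans′ (inj₁ (¬rx , x≈y)) (inj₂ (inj₁ (ry , _)))      = ⊥-elim (¬rx (R-resp⁻ x≈y ry))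
    trans′ (inj₁ (¬rx , x≈y)) (inj₂ (inj₂ (ry , _)))      = ⊥-elim (¬rx (R-resp⁻ x≈y ry))
    trans′ (inj₂ (inj₁ (rx , x≈y , _))) (inj₁ (¬ry , _))  = ⊥-elim (¬ry (R-resp x≈y rx))
    trans′ (inj₂ (inj₂ (rx , x≈y , _))) (inj₁ (¬ry , _))  = ⊥-elim (¬ry (R-resp x≈y rx))
    trans′ (inj₂ (inj₁ (rx , x≈y , xx , _))) (inj₂ (inj₁ (_ , y≈z , _ , xz))) =
      inj₂ (inj₁ (rx , trans x≈y y≈z , xx , xz))
    trans′ (inj₂ (inj₂ (rx , x≈y , ¬xx , _))) (inj₂ (inj₂ (_ , y≈z , _ , ¬xz))) =
      inj₂ (inj₂ (rx , trans x≈y y≈z , ¬xx , ¬xz))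
    trans′ (inj₂ (inj₁ (_ , _ , _ , xy))) (inj₂ (inj₂ (_ , _ , ¬xy , _))) = ⊥-elim (¬xy xy)
    trans′ (inj₂ (inj₂ (_ , _ , _ , ¬xy))) (inj₂ (inj₁ (_ , _ , xy , _))) = ⊥-elim (¬xy xy)

module Algorithm2 (em : ExcludedMiddle 0ℓ) (G : TS) where
  open TS G
  open Alg2 G

  record Is2PR (st : AState) : Set where
    field
      PEq-isEquivalence : IsEquivalence (PEq st)
      QEq-isEquivalence : IsEquivalence (QEq st)
      Tau-respˡ : ∀ {u v w} → PEq st u v → Tau st u w → Tau st v w
      Tau-respʳ : ∀ {u v w} → QEq st v w → Tau st u v → Tau st u w

  initState-Is2PR : ∀ Ri σi → Is2PR (initState Ri σi)
  initState-Is2PR Ri σi = record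
    { PEq-isEquivalence = On.isEquivalence Ri SetEq-isEquivalence
    ; QEq-isEquivalence = On.isEquivalence (flip Ri) SetEq-isEquivalence
    ; Tau-respˡ = λ u≈v t w q → let (z , u≈z , z≲w) = t w q in z , SetEq.trans (SetEq.sym u≈v) u≈z , z≲w
    ; Tau-respʳ = λ v≈w t w′ q → t w′ (SetEq.trans v≈w q)
    }

  module Refine {st : AState} (wf : Is2PR st) (a : Lab) (b c : St) where
    open Is2PR wf
    module P = IsEquivalence PEq-isEquivalence
    module Q = IsEquivalence QEq-isEquivalence

    st′ : AState
    st′ = apply st (refine a b c)

    -- These mirror the local definitions of apply (refine a b c), which makes
    -- QEq st′ definitionally splitWithin (QEq st) Split S.
    B : Pred St 0ℓ
    B z = PEq st b z
    S : Pred St 0ℓ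
    S = pre a (Tau st c)
    preC : Pred St 0ℓ
    preC = pre a (PEq st c)
    Split : Pred St 0ℓ
    Split x = ∃ λ w → Tau st b w × QEq st w x
              × (∃ λ z → QEq st w z × S z)
              × ¬ (∀ z → QEq st w z → S z)

    module Pˢ = SplitWithin (PEq st) B preC
    module Qˢ = SplitWithin (QEq st) Split S

    -- The only block whose image τ changes (step 4).
    B′ : Pred St 0ℓ
    B′ z = B z × preC z

    B-resp : B Respects PEq st
    B-resp x≈y bx = P.trans bx x≈y

    Split-resp : Split Respects QEq st
    Split-resp x≈y (w , t , w≈x , e , ne) = w , t , Q.trans w≈x x≈y , e , ne

    -- Defs phrases P′ with B y where splitWithin has x ≈ y; they agree since B is a P-block.
    PEq′⇒split : ∀ {x y} → PEq st′ x y → splitWithin (PEq st) B preC x y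
    PEq′⇒split (inj₁ p)                            = inj₁ p
    PEq′⇒split (inj₂ (inj₁ (bx , by , px , py)))   = inj₂ (inj₁ (bx , P.trans (P.sym bx) by , px , py))
    PEq′⇒split (inj₂ (inj₂ (bx , by , ¬px , ¬py))) = inj₂ (inj₂ (bx , P.trans (P.sym bx) by , ¬px , ¬py))

    split⇒PEq′ : ∀ {x y} → splitWithin (PEq st) B preC x y → PEq st′ x y
    split⇒PEq′ (inj₁ p)                              = inj₁ p
    split⇒PEq′ (inj₂ (inj₁ (bx , x≈y , px , py)))   = inj₂ (inj₁ (bx , P.trans bx x≈y , px , py))
    split⇒PEq′ (inj₂ (inj₂ (bx , x≈y , ¬px , ¬py))) = inj₂ (inj₂ (bx , P.trans bx x≈y , ¬px , ¬py))

    PEq′-isEquivalence : IsEquivalence (PEq st′)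
    PEq′-isEquivalence = record
      { refl  = split⇒PEq′ Eq.refl
      ; sym   = split⇒PEq′ ∘ Eq.sym ∘ PEq′⇒split
      ; trans = λ e f → split⇒PEq′ (Eq.trans (PEq′⇒split e) (PEq′⇒split f))
      }
      where module Eq = IsEquivalence (Pˢ.splitWithin-isEquivalence em PEq-isEquivalence B-resp)

    QEq′-isEquivalence : IsEquivalence (QEq st′)
    QEq′-isEquivalence = Qˢ.splitWithin-isEquivalence em QEq-isEquivalence Split-resp

    module P′ = IsEquivalence PEq′-isEquivalence
    module Q′ = IsEquivalence QEq′-isEquivalence

    PEq′⊆PEq : ∀ {x y} → PEq st′ x y → PEq st x y
    PEq′⊆PEq = Pˢ.splitWithin⇒≈ ∘ PEq′⇒split

    QEq′⊆QEq : ∀ {x y} → QEq st′ x y → QEq st x y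
    QEq′⊆QEq = Qˢ.splitWithin⇒≈

    B′-resp : B′ Respects PEq st′
    B′-resp e (bx , px) = B-resp (PEq′⊆PEq e) bx , Pˢ.splitWithin-closed bx px (PEq′⇒split e)

    Tau′-outside : ∀ {z y} → ¬ B′ z → Tau st z y → Tau st′ z y
    Tau′-outside ¬b′ t = inj₁ (¬b′ , t)

    Tau′-inside : ∀ {z y} → B′ z → Tau st z y → (∀ w → QEq st′ y w → S w) → Tau st′ z y
    Tau′-inside (bz , pz) t inS = inj₂ (bz , pz , t , inS)

    Tau′-inside⊆S : ∀ {z} → B′ z → Tau st′ z ⊆ S
    Tau′-inside⊆S b′ (inj₁ (¬b′ , _))         = ⊥-elim (¬b′ b′)
    Tau′-inside⊆S _  (inj₂ (_ , _ , _ , inS)) = inS _ Q′.refl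

    Tau′-respˡ : ∀ {u v w} → PEq st′ u v → Tau st′ u w → Tau st′ v w
    Tau′-respˡ u≈′v (inj₁ (¬b′u , t)) =
      Tau′-outside (¬b′u ∘ B′-resp (P′.sym u≈′v)) (Tau-respˡ (PEq′⊆PEq u≈′v) t)
    Tau′-respˡ u≈′v (inj₂ (bu , pu , t , inS)) =
      Tau′-inside (B′-resp u≈′v (bu , pu)) (Tau-respˡ (PEq′⊆PEq u≈′v) t) inS

    Tau′-respʳ : ∀ {u v w} → QEq st′ v w → Tau st′ u v → Tau st′ u w
    Tau′-respʳ v≈′w (inj₁ (¬b′u , t)) =
      Tau′-outside ¬b′u (Tau-respʳ (QEq′⊆QEq v≈′w) t)
    Tau′-respʳ v≈′w (inj₂ (bu , pu , t , inS)) =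
      Tau′-inside (bu , pu) (Tau-respʳ (QEq′⊆QEq v≈′w) t) (λ w → inS w ∘ Q′.trans v≈′w)

    ∃Tau-outside-S : InV st a b c → ∃ λ y₀ → Tau st b y₀ × ¬ S y₀
    ∃Tau-outside-S (_ , _ , τB⊈S) =
      decidable-stable em λ ∄ → τB⊈S λ y t → decidable-stable em λ ¬s → ∄ (y , t , ¬s)

    Tau′-differ : ∀ {y₀ x y} → Tau st b y₀ → ¬ S y₀ → B x → preC x → PEq st x y → ¬ preC y →
      ¬ SetEq (Tau st′ x) (Tau st′ y)
    Tau′-differ {y₀} t₀ ¬s₀ bx px x≈y ¬py x≐y =
      ¬s₀ (Tau′-inside⊆S (bx , px) (Equivalence.from (x≐y y₀)
        (Tau′-outside (¬py ∘ proj₂) (Tau-respˡ (P.trans bx x≈y) t₀))))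

    refine-separatesᴾ : InV st a b c → ∀ {x y} → PEq st x y → ¬ PEq st′ x y →
      ¬ SetEq (Tau st′ x) (Tau st′ y)
    refine-separatesᴾ inV x≈y x≉′y
      with ∃Tau-outside-S inV | Pˢ.¬splitWithin⇒separated em x≈y (x≉′y ∘ split⇒PEq′)
    ... | y₀ , t₀ , ¬s₀ | bx , inj₁ (px , ¬py) = Tau′-differ t₀ ¬s₀ bx px x≈y ¬py
    ... | y₀ , t₀ , ¬s₀ | bx , inj₂ (¬px , py) =
      Tau′-differ t₀ ¬s₀ (B-resp x≈y bx) py (P.sym x≈y) ¬px ∘ SetEq.sym

    Tau′⁻¹-differ : ∀ {z₀ x y} → B′ z₀ → Split x → S x → ¬ S y →
      ¬ SetEq (Rel2PRinv st′ x) (Rel2PRinv st′ y)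
    Tau′⁻¹-differ {z₀} b′z₀@(bz₀ , _) split@(w , tbw , w≈x , _) sx ¬sy x≐y =
      ¬sy (Tau′-inside⊆S b′z₀ (Equivalence.to (x≐y z₀)
        (Tau′-inside b′z₀ (Tau-respˡ bz₀ (Tau-respʳ w≈x tbw)) (λ _ → Qˢ.splitWithin-closed split sx))))

    refine-separatesᵠ : InV st a b c → ∀ {x y} → QEq st x y → ¬ QEq st′ x y →
      ¬ SetEq (Rel2PRinv st′ x) (Rel2PRinv st′ y)
    refine-separatesᵠ (_ , (_ , b′z₀) , _) x≈y x≉′y with Qˢ.¬splitWithin⇒separated em x≈y x≉′y
    ... | split , inj₁ (sx , ¬sy) = Tau′⁻¹-differ b′z₀ split sx ¬sy
    ... | split , inj₂ (¬sx , sy) = Tau′⁻¹-differ b′z₀ (Split-resp x≈y split) sy ¬sx ∘ SetEq.sym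

    Is2PR-st′ : Is2PR st′
    Is2PR-st′ = record
      { PEq-isEquivalence = PEq′-isEquivalence
      ; QEq-isEquivalence = QEq′-isEquivalence
      ; Tau-respˡ = Tau′-respˡ
      ; Tau-respʳ = Tau′-respʳ
      }

  apply-Is2PR : ∀ {st} → Is2PR st → ∀ ch → Is2PR (apply st ch)
  apply-Is2PR wf (search _ _)   = record { Is2PR wf }
  apply-Is2PR wf (refine a b c) = Refine.Is2PR-st′ wf a b c

  ImagesDiffer : AState → Rel St 0ℓ
  ImagesDiffer st x y = ¬ SetEq (Rel2PR st x) (Rel2PR st y)

  PreimagesDiffer : AState → Rel St 0ℓ
  PreimagesDiffer st x y = ¬ SetEq (Rel2PRinv st x) (Rel2PRinv st y)

  step-separatesᴾ : ∀ {st ch x y} → Is2PR st → Enabled st ch →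
    PEq st x y → ¬ PEq (apply st ch) x y → ImagesDiffer (apply st ch) x y
  step-separatesᴾ {ch = search _ _}   _  _   x≈y x≉′y = ⊥-elim (x≉′y x≈y)
  step-separatesᴾ {ch = refine a b c} wf inV x≈y x≉′y = Refine.refine-separatesᴾ wf a b c inV x≈y x≉′y

  step-separatesᵠ : ∀ {st ch x y} → Is2PR st → Enabled st ch →
    QEq st x y → ¬ QEq (apply st ch) x y → PreimagesDiffer (apply st ch) x y
  step-separatesᵠ {ch = search _ _}   _  _   x≈y x≉′y = ⊥-elim (x≉′y x≈y)
  step-separatesᵠ {ch = refine a b c} wf inV x≈y x≉′y = Refine.refine-separatesᵠ wf a b c inV x≈y x≉′y

  first-separating-step : (E D : AState → Rel St 0ℓ) →
    (∀ {st ch x y} → Is2PR st → Enabled st ch → E st x y → ¬ E (apply st ch) x y → D (apply st ch) x y) →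
    ∀ {st x y} cs → Is2PR st → Valid st cs → E st x y → ¬ E (run st cs) x y →
    ∃ λ j → j ≤ length cs × D (run st (take j cs)) x y
  first-separating-step E D separates []        _  _            e ¬e = ⊥-elim (¬e e)
  first-separating-step E D separates {st} {x} {y} (ch ∷ cs) wf (enabled , valid) e ¬e
    with em {E (apply st ch) x y}
  ... | no ¬e′ = 1 , s≤s z≤n , separates wf enabled e ¬e′
  ... | yes e′ =
    let j , j≤ , d = first-separating-step E D separates cs (apply-Is2PR wf ch) valid e′ ¬e
    in suc j , s≤s j≤ , d

mainTheorem6 : ExcludedMiddle 0ℓ →
    (G : TS) (Ri : Rel (TS.St G) 0ℓ) → IsPreorder _≡_ Ri →
    (σi : Pred (TS.St G) 0ℓ) → σi ⊆ Alg2.PostStar G (TS.Init G) →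
    (cs : List (Alg2.Choice G)) →
    Alg2.Valid G (Alg2.initState G Ri σi) cs →
    Alg2.Terminal G (Alg2.run G (Alg2.initState G Ri σi) cs) →
    (x y : TS.St G) → SetEq (Ri x) (Ri y) →
    (¬ Alg2.PEq (Alg2.run G (Alg2.initState G Ri σi) cs) x y →
      ∃ λ j → j ≤ length cs ×
        ¬ SetEq (Alg2.Rel2PR G (Alg2.run G (Alg2.initState G Ri σi) (take j cs)) x)
                (Alg2.Rel2PR G (Alg2.run G (Alg2.initState G Ri σi) (take j cs)) y))
    × (¬ Alg2.QEq (Alg2.run G (Alg2.initState G Ri σi) cs) x y →
      ∃ λ j → j ≤ length cs ×
        ¬ SetEq (Alg2.Rel2PRinv G (Alg2.run G (Alg2.initState G Ri σi) (take j cs)) x)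
                (Alg2.Rel2PRinv G (Alg2.run G (Alg2.initState G Ri σi) (take j cs)) y))
mainTheorem6 em G Ri Ri-preorder σi _ cs valid _ x y Rix≐Riy =
    first-separating-step PEq ImagesDiffer step-separatesᴾ cs wf valid Rix≐Riy
  , first-separating-step QEq PreimagesDiffer step-separatesᵠ cs wf valid
      (preorder-image⇒preimage Ri-preorder Rix≐Riy)
  where
  open Alg2 G using (PEq; QEq)
  open Algorithm2 em G
  wf : Is2PR (Alg2.initState G Ri σi)
  wf = initState-Is2PR Ri σi
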